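{- Let $m \in \mathbb{N}$, $n = 2^m$, and let $\mathcal{H} \subset \mathbb{R}^n$ be the Hadamard polytope. Then the number of integer points of $\mathcal{H}$ satisfies $|\mathcal{H} \cap \mathbb{Z}^n| = n^{\Theta(\log n)}$, i.e. there are absolute constants $C_1, C_2 > 0$ such that $n^{C_1 \log n} \le |\mathcal{H} \cap \mathbb{Z}^n| \le n^{C_2 \log n}$ for all sufficiently large such $n$.
   Context: Let $n = 2^m$. The $n \times n$ Hadamard matrix $H$ has rows and columns indexed by elements of $\mathbb{F}_2^m$, with $H(a,b) = (-1)^{\langle a,b\rangle}$, where $\langle a,b\rangle$ is the standard dot product on $\mathbb{F}_2^m$. The Hadamard polytope $\mathcal{H} \subset \mathbb{R}^n$ is the convex hull of the column vectors of $H$. Logarithms are base $2$. -}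

module Defs where

open import Data.Bool using (Bool; true; false; _∧_; _xor_; if_then_else_)
open import Data.Nat as ℕ using (ℕ; zero; suc)
open import Data.Integer as ℤ using (ℤ)
open import Data.Rational using (ℚ; 0ℚ; 1ℚ; _+_; _*_; -_; _≤_; _/_)
open import Data.Vec using (Vec; []; _∷_; foldr)
open import Data.List as List using (List; []; _∷_; length)
open import Data.List.Relation.Unary.All using (All)
open import Data.List.Relation.Unary.Any using (Any)
open import Data.List.Relation.Unary.AllPairs using (AllPairs)
open import Data.Product using (Σ; _×_)
open import Relation.Binary.PropositionalEquality using (_≡_; _≗_)
open import Relation.Nullary using (¬_)

𝔽₂^ : ℕ → Set
𝔽₂^ m = Vec Bool m

dot : ∀ {m} → 𝔽₂^ m → 𝔽₂^ m → Bool
dot [] [] = false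
dot (a ∷ as) (b ∷ bs) = (a ∧ b) xor dot as bs

allVecs : (m : ℕ) → List (𝔽₂^ m)
allVecs zero = [] ∷ []
allVecs (suc m) = List.map (false ∷_) (allVecs m) List.++ List.map (true ∷_) (allVecs m)

H : ∀ {m} → 𝔽₂^ m → 𝔽₂^ m → ℚ
H a b = if dot a b then - 1ℚ else 1ℚ

Σ𝔽 : ∀ m → (𝔽₂^ m → ℚ) → ℚ
Σ𝔽 m f = List.foldr (λ b acc → f b + acc) 0ℚ (allVecs m)

-- Points of R^n (n = 2^m) with coordinates indexed by F_2^m, rational / integer versions.
ℚPoint : ℕ → Set
ℚPoint m = 𝔽₂^ m → ℚ

ℤPoint : ℕ → Set
ℤPoint m = 𝔽₂^ m → ℤ

InHadamardPolytope : ∀ m → ℚPoint m → Set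
InHadamardPolytope m x =
  Σ (𝔽₂^ m → ℚ) λ c →
    (∀ b → 0ℚ ≤ c b) ×
    (Σ𝔽 m c ≡ 1ℚ) ×
    (∀ a → Σ𝔽 m (λ b → c b * H a b) ≡ x a)

toℚPoint : ∀ {m} → ℤPoint m → ℚPoint m
toℚPoint x a = x a / 1

IntegerPoint : ∀ m → ℤPoint m → Set
IntegerPoint m x = InHadamardPolytope m (toℚPoint x)

NumIntegerPoints : ∀ m → ℕ → Set
NumIntegerPoints m N =
  Σ (List (ℤPoint m)) λ L →
    (length L ≡ N) ×
    All (IntegerPoint m) L ×
    (∀ x → IntegerPoint m x → Any (x ≗_) L) ×
    AllPairs (λ x y → ¬ (x ≗ y)) L

-- Write 𝓗ₘ for the Hadamard polytope in dimension 2^m and split a point x of 𝓗ₘ₊₁ into its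
-- lower half y (first bit 0) and upper half z (first bit 1). Since H_{m+1} = [[H, H], [H, -H]],
-- a convex combination c of the columns of H_{m+1} gives y = H(c⁰ + c¹) and z = H(c⁰ - c¹), so
-- y ∈ 𝓗ₘ; conversely (H c, H h) ∈ 𝓗ₘ₊₁ whenever c is a probability vector and |h| ≤ c.
-- If x is integral and z(s) ≠ 0, then z(s) = ±1 is an extreme value of the transform of a
-- probability vector, which forces that vector onto a coset of a hyperplane, and then
-- z(a) = ±y(s ⊕ a) for all a. Hence an integer point of 𝓗ₘ₊₁ is determined by one of 𝓗ₘ and
-- one of 1 + 2^{m+1} choices of its upper half, so |𝓗ₘ ∩ ℤ^n| ≤ 2^{m(m+1)}.
-- For the lower bound, the shifted extensions of the indicator of the origin give, in dimension
-- 2^{j+k}, the indicators of the graphs of all 2^{jk} linear maps F₂^j → F₂^k; taking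
-- j = ⌈m/2⌉ and k = ⌊m/2⌋ gives |𝓗ₘ ∩ ℤ^n| ≥ 2^{jk} ≥ 2^{m²/6}.
module Submission where

open import Defs
open import Level using (0ℓ)
open import Algebra.Bundles using (CommutativeRing)
open import Data.Bool using (Bool; true; false; _∧_; _xor_; if_then_else_)
open import Data.Bool.Properties
  using (xor-∧-commutativeRing; xor-assoc; xor-same; xor-identityˡ; xor-identityʳ;
         ∧-distribʳ-xor; ∧-zeroʳ; ∧-identityʳ)
open import Data.Nat using (ℕ; zero; suc; z≤n; s≤s)
open import Data.Integer as ℤ using (ℤ; +0; -[1+_]; +[1+_]; 0ℤ; 1ℤ)
open import Data.Vec using (Vec; []; _∷_; _++_; take; drop; replicate; zipWith)
open import Data.Vec.Properties
  using (zipWith-assoc; zipWith-identityˡ; zipWith-identityʳ; take++drop≡id; ∷-injectiveʳ)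
open import Data.List as List
  using (List; []; _∷_; length; cartesianProduct; cartesianProductWith; deduplicate)
open import Data.List.Relation.Unary.All as All using (All; []; _∷_)
import Data.List.Relation.Unary.All.Properties as Allₚ
open import Data.List.Relation.Unary.Any as Any using (Any; here; there; _─_)
open import Data.List.Membership.Propositional using (_∈_)
open import Data.List.Membership.Propositional.Properties
  using (∈-map⁺; ∈-++⁺ˡ; ∈-++⁺ʳ; ∈-cartesianProduct⁺)
open import Data.Maybe using (Maybe; nothing; just)
open import Data.Product using (Σ; _×_; _,_; proj₁; proj₂)
open import Data.Sum using (_⊎_; inj₁; inj₂)
open import Function using (_∘_)
open import Relation.Binary using (Setoid; DecSetoid)
open import Relation.Binary.PropositionalEquality
open import Relation.Nullary using (¬_; Dec; yes; no; contradiction)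

open import Algebra.Properties.CommutativeSemigroup
  (CommutativeRing.+-commutativeSemigroup xor-∧-commutativeRing)
  using () renaming (interchange to xor-interchange)

_⊕_ : ∀ {m} → 𝔽₂^ m → 𝔽₂^ m → 𝔽₂^ m
_⊕_ = zipWith _xor_

zeros : ∀ m → 𝔽₂^ m
zeros m = replicate m false

⊕-self : ∀ {m} (s : 𝔽₂^ m) → s ⊕ s ≡ zeros m
⊕-self [] = refl
⊕-self (x ∷ s) = cong₂ _∷_ (xor-same x) (⊕-self s)

⊕-cancelˡ : ∀ {m} (s a : 𝔽₂^ m) → s ⊕ (s ⊕ a) ≡ a
⊕-cancelˡ {m} s a = begin
  s ⊕ (s ⊕ a)  ≡⟨ zipWith-assoc xor-assoc s s a ⟨
  (s ⊕ s) ⊕ a  ≡⟨ cong (_⊕ a) (⊕-self s) ⟩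
  zeros m ⊕ a  ≡⟨ zipWith-identityˡ xor-identityˡ a ⟩
  a            ∎
  where open ≡-Reasoning

⊕≡zeros⇒≡ : ∀ {m} (p q : 𝔽₂^ m) → p ⊕ q ≡ zeros m → p ≡ q
⊕≡zeros⇒≡ {m} p q p⊕q≡0 = begin
  p            ≡⟨ zipWith-identityʳ xor-identityʳ p ⟨
  p ⊕ zeros m  ≡⟨ cong (p ⊕_) p⊕q≡0 ⟨
  p ⊕ (p ⊕ q)  ≡⟨ ⊕-cancelˡ p q ⟩
  q            ∎
  where open ≡-Reasoning

zeros++-⊕ : ∀ j {k} (r w : 𝔽₂^ k) → (zeros j ++ r) ⊕ (zeros j ++ w) ≡ zeros j ++ (r ⊕ w)
zeros++-⊕ zero r w = refl
zeros++-⊕ (suc j) r w = cong (false ∷_) (zeros++-⊕ j r w)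

dot-⊕ˡ : ∀ {m} (p q b : 𝔽₂^ m) → dot (p ⊕ q) b ≡ dot p b xor dot q b
dot-⊕ˡ [] [] [] = refl
dot-⊕ˡ (p ∷ ps) (q ∷ qs) (b ∷ bs) = begin
  ((p xor q) ∧ b) xor dot (ps ⊕ qs) bs
    ≡⟨ cong₂ _xor_ (∧-distribʳ-xor b p q) (dot-⊕ˡ ps qs bs) ⟩
  ((p ∧ b) xor (q ∧ b)) xor (dot ps bs xor dot qs bs)
    ≡⟨ xor-interchange (p ∧ b) (q ∧ b) (dot ps bs) (dot qs bs) ⟩
  ((p ∧ b) xor dot ps bs) xor ((q ∧ b) xor dot qs bs) ∎
  where open ≡-Reasoning

allVecs-complete : ∀ {m} (a : 𝔽₂^ m) → a ∈ allVecs m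
allVecs-complete [] = here refl
allVecs-complete (false ∷ a) = ∈-++⁺ˡ (∈-map⁺ (false ∷_) (allVecs-complete a))
allVecs-complete {suc m} (true ∷ a) =
  ∈-++⁺ʳ (List.map (false ∷_) (allVecs m)) (∈-map⁺ (true ∷_) (allVecs-complete a))

∀-or-∃¬ : ∀ {m} {P : 𝔽₂^ m → Set} → (∀ a → Dec (P a)) →
          (∀ a → P a) ⊎ Σ (𝔽₂^ m) (¬_ ∘ P)
∀-or-∃¬ {m} P? with All.all? P? (allVecs m)
... | yes ∀P = inj₁ (λ a → All.lookup ∀P (allVecs-complete a))
... | no ¬∀P = inj₂ (Any.satisfied (Allₚ.¬All⇒Any¬ P? (allVecs m) ¬∀P))

lowerHalf : ∀ {m} → ℤPoint (suc m) → ℤPoint m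
lowerHalf x a = x (false ∷ a)

signed : Bool → ℤ → ℤ
signed false z = z
signed true z = ℤ.- z

Shape : ℕ → Set
Shape m = Maybe (Bool × 𝔽₂^ m)

upper : ∀ {m} → ℤPoint m → Shape m → ℤPoint m
upper y nothing a = 0ℤ
upper y (just (σ , s)) a = signed σ (y (s ⊕ a))

extend : ∀ {m} → ℤPoint m → Shape m → ℤPoint (suc m)
extend y t (false ∷ a) = y a
extend y t (true ∷ a) = upper y t a

extend-cong : ∀ {m} {y y′ : ℤPoint m} {t t′} → y ≗ y′ → t ≡ t′ → extend y t ≗ extend y′ t′
extend-cong y≗y′ refl (false ∷ a) = y≗y′ a
extend-cong {t = nothing} y≗y′ refl (true ∷ a) = refl
extend-cong {t = just (σ , s)} y≗y′ refl (true ∷ a) = cong (signed σ) (y≗y′ (s ⊕ a))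

≗-extend : ∀ {m} {x : ℤPoint (suc m)} {t} →
           (∀ a → x (true ∷ a) ≡ upper (lowerHalf x) t a) → x ≗ extend (lowerHalf x) t
≗-extend upper≡ (false ∷ a) = refl
≗-extend upper≡ (true ∷ a) = upper≡ a

one₀ : ℤPoint 0
one₀ _ = 1ℤ

module Polytope where

  open import Data.Rational
    using (ℚ; 0ℚ; 1ℚ; ½; mkℚ; _+_; _-_; _*_; -_; _≤_; _/_; ↥_; *≤*)
  import Data.Rational.Properties as ℚ
  open import Data.Nat.Coprimality using (1-coprimeTo) renaming (sym to coprime-sym)
  open import Relation.Nullary.Decidable using (dec⇒maybe)
  open import Tactic.RingSolver using (solve-∀)
  open import Tactic.RingSolver.Core.AlmostCommutativeRing
    using (AlmostCommutativeRing; fromCommutativeRing)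

  open ≡-Reasoning

  ℚ-ring : AlmostCommutativeRing 0ℓ 0ℓ
  ℚ-ring = fromCommutativeRing ℚ.+-*-commutativeRing (λ x → dec⇒maybe (0ℚ ℚ.≟ x))

  -- z / 1 is computed by gcd normalisation, so it does not reduce for a variable z;
  -- fromℤ z is the same rational with z as literal numerator.
  fromℤ : ℤ → ℚ
  fromℤ z = mkℚ z 0 (coprime-sym (1-coprimeTo ℤ.∣ z ∣))

  /1≡fromℤ : ∀ z → z / 1 ≡ fromℤ z
  /1≡fromℤ z = ℚ.↥p/↧p≡p (fromℤ z)

  /1-injective : ∀ {z w} → z / 1 ≡ w / 1 → z ≡ w
  /1-injective {z} {w} eq = cong ↥_ (trans (sym (/1≡fromℤ z)) (trans eq (/1≡fromℤ w)))

  sign : Bool → ℚ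
  sign b = if b then - 1ℚ else 1ℚ

  sign-xor : ∀ x y → sign (x xor y) ≡ sign x * sign y
  sign-xor false false = refl
  sign-xor false true = refl
  sign-xor true false = refl
  sign-xor true true = refl

  sign*sign : ∀ x → sign x * sign x ≡ 1ℚ
  sign*sign false = refl
  sign*sign true = refl

  neg-fromℤ : ∀ z → - fromℤ z ≡ fromℤ (ℤ.- z)
  neg-fromℤ +0 = refl
  neg-fromℤ +[1+ n ] = refl
  neg-fromℤ -[1+ n ] = refl

  signed-/1 : ∀ σ z → signed σ z / 1 ≡ sign σ * (z / 1)
  signed-/1 false z = sym (ℚ.*-identityˡ (z / 1))
  signed-/1 true z = begin
    (ℤ.- z) / 1      ≡⟨ /1≡fromℤ (ℤ.- z) ⟩
    fromℤ (ℤ.- z)    ≡⟨ neg-fromℤ z ⟨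
    - fromℤ z        ≡⟨ cong -_ (/1≡fromℤ z) ⟨
    - (z / 1)        ≡⟨ neg≡-1* (z / 1) ⟩
    - 1ℚ * (z / 1)   ∎
    where
    neg≡-1* : ∀ x → - x ≡ - 1ℚ * x
    neg≡-1* = solve-∀ ℚ-ring

  fromℤ-unit : ∀ z → - 1ℚ ≤ fromℤ z → fromℤ z ≤ 1ℚ → z ≢ 0ℤ →
               Σ Bool λ σ → fromℤ z ≡ sign σ
  fromℤ-unit +0 _ _ z≢0 = contradiction refl z≢0
  fromℤ-unit +[1+ zero ] _ _ _ = false , refl
  fromℤ-unit +[1+ suc n ] _ (*≤* (ℤ.+≤+ (s≤s ()))) _
  fromℤ-unit -[1+ zero ] _ _ _ = true , refl
  fromℤ-unit -[1+ suc n ] (*≤* (ℤ.-≤- ())) _ _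

  -p≤p : ∀ {p} → 0ℚ ≤ p → - p ≤ p
  -p≤p 0≤p = ℚ.≤-trans (ℚ.neg-antimono-≤ 0≤p) 0≤p

  *sign-bounds : ∀ {x} → 0ℚ ≤ x → ∀ d → - x ≤ x * sign d × x * sign d ≤ x
  *sign-bounds {x} 0≤x false =
    ℚ.≤-trans (-p≤p 0≤x) (ℚ.≤-reflexive (sym (ℚ.*-identityʳ x))) , ℚ.≤-reflexive (ℚ.*-identityʳ x)
  *sign-bounds {x} 0≤x true =
    ℚ.≤-reflexive (sym (x*-1≡-x x)) , ℚ.≤-trans (ℚ.≤-reflexive (x*-1≡-x x)) (-p≤p 0≤x)
    where
    x*-1≡-x : ∀ x → x * - 1ℚ ≡ - x
    x*-1≡-x = solve-∀ ℚ-ring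

  p≤q⇒0≤q-p : ∀ {p q} → p ≤ q → 0ℚ ≤ q - p
  p≤q⇒0≤q-p {p} p≤q = ℚ.≤-trans (ℚ.≤-reflexive (sym (ℚ.+-inverseʳ p))) (ℚ.+-monoˡ-≤ (- p) p≤q)

  p-q≡0⇒p≡q : ∀ {p q} → p - q ≡ 0ℚ → p ≡ q
  p-q≡0⇒p≡q {p} {q} p-q≡0 = begin
    p              ≡⟨ p≡p-q+q p q ⟩
    (p - q) + q    ≡⟨ cong (_+ q) p-q≡0 ⟩
    0ℚ + q         ≡⟨ ℚ.+-identityˡ q ⟩
    q              ∎
    where
    p≡p-q+q : ∀ p q → p ≡ (p - q) + q
    p≡p-q+q = solve-∀ ℚ-ring

  ∑ : ∀ {A : Set} → List A → (A → ℚ) → ℚ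
  ∑ xs f = List.foldr (λ b acc → f b + acc) 0ℚ xs

  module _ {A : Set} where

    ∑-++ : ∀ (xs ys : List A) f → ∑ (xs List.++ ys) f ≡ ∑ xs f + ∑ ys f
    ∑-++ [] ys f = sym (ℚ.+-identityˡ _)
    ∑-++ (x ∷ xs) ys f = trans (cong (f x +_) (∑-++ xs ys f)) (sym (ℚ.+-assoc (f x) _ _))

    ∑-cong : ∀ (xs : List A) {f g} → (∀ b → f b ≡ g b) → ∑ xs f ≡ ∑ xs g
    ∑-cong [] f≗g = refl
    ∑-cong (x ∷ xs) f≗g = cong₂ _+_ (f≗g x) (∑-cong xs f≗g)

    ∑-+ : ∀ (xs : List A) f g → ∑ xs (λ b → f b + g b) ≡ ∑ xs f + ∑ xs g
    ∑-+ [] f g = refl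
    ∑-+ (x ∷ xs) f g = trans (cong (f x + g x +_) (∑-+ xs f g)) (medial (f x) (g x) _ _)
      where
      medial : ∀ a b c d → (a + b) + (c + d) ≡ (a + c) + (b + d)
      medial = solve-∀ ℚ-ring

    ∑-*ˡ : ∀ (xs : List A) k f → ∑ xs (λ b → k * f b) ≡ k * ∑ xs f
    ∑-*ˡ [] k f = sym (ℚ.*-zeroʳ k)
    ∑-*ˡ (x ∷ xs) k f = trans (cong (k * f x +_) (∑-*ˡ xs k f)) (sym (ℚ.*-distribˡ-+ k (f x) _))

    ∑-neg : ∀ (xs : List A) f → ∑ xs (λ b → - f b) ≡ - ∑ xs f
    ∑-neg [] f = refl
    ∑-neg (x ∷ xs) f = trans (cong (- f x +_) (∑-neg xs f)) (sym (ℚ.neg-distrib-+ (f x) _))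

    ∑-- : ∀ (xs : List A) f g → ∑ xs (λ b → f b - g b) ≡ ∑ xs f - ∑ xs g
    ∑-- xs f g = trans (∑-+ xs f (λ b → - g b)) (cong (∑ xs f +_) (∑-neg xs g))

    ∑-0 : ∀ (xs : List A) → ∑ xs (λ _ → 0ℚ) ≡ 0ℚ
    ∑-0 [] = refl
    ∑-0 (x ∷ xs) = cong (0ℚ +_) (∑-0 xs)

    ∑-mono : ∀ (xs : List A) {f g} → (∀ b → f b ≤ g b) → ∑ xs f ≤ ∑ xs g
    ∑-mono [] f≤g = ℚ.≤-refl
    ∑-mono (x ∷ xs) f≤g = ℚ.+-mono-≤ (f≤g x) (∑-mono xs f≤g)

    ∑-nonNeg : ∀ (xs : List A) {f} → (∀ b → 0ℚ ≤ f b) → 0ℚ ≤ ∑ xs f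
    ∑-nonNeg xs {f} f≥0 = subst (_≤ ∑ xs f) (∑-0 xs) (∑-mono xs f≥0)

    ∑-nonNeg≡0 : ∀ (xs : List A) {f} → (∀ b → 0ℚ ≤ f b) → ∑ xs f ≡ 0ℚ → All (λ b → f b ≡ 0ℚ) xs
    ∑-nonNeg≡0 [] f≥0 ∑f≡0 = []
    ∑-nonNeg≡0 (x ∷ xs) {f} f≥0 ∑f≡0 = proj₁ both≡0 ∷ ∑-nonNeg≡0 xs f≥0 (proj₂ both≡0)
      where
      +≡0 : ∀ {p q} → 0ℚ ≤ p → 0ℚ ≤ q → p + q ≡ 0ℚ → p ≡ 0ℚ
      +≡0 {p} {q} 0≤p 0≤q p+q≡0 = ℚ.≤-antisym
        (ℚ.≤-trans (ℚ.≤-reflexive (sym (ℚ.+-identityʳ p)))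
                   (ℚ.≤-trans (ℚ.+-monoʳ-≤ p 0≤q) (ℚ.≤-reflexive p+q≡0)))
        0≤p
      both≡0 : f x ≡ 0ℚ × ∑ xs f ≡ 0ℚ
      both≡0 = +≡0 (f≥0 x) (∑-nonNeg xs f≥0) ∑f≡0
             , +≡0 (∑-nonNeg xs f≥0) (f≥0 x) (trans (ℚ.+-comm (∑ xs f) (f x)) ∑f≡0)

  ∑-map : ∀ {A B : Set} (g : A → B) (xs : List A) f → ∑ (List.map g xs) f ≡ ∑ xs (f ∘ g)
  ∑-map g [] f = refl
  ∑-map g (x ∷ xs) f = cong (f (g x) +_) (∑-map g xs f)

  Σ𝔽-suc : ∀ m f → Σ𝔽 (suc m) f ≡ Σ𝔽 m (λ b → f (false ∷ b)) + Σ𝔽 m (λ b → f (true ∷ b))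
  Σ𝔽-suc m f = trans (∑-++ (List.map (false ∷_) (allVecs m)) _ f)
                     (cong₂ _+_ (∑-map (false ∷_) (allVecs m) f) (∑-map (true ∷_) (allVecs m) f))

  hadamard : ∀ m → (𝔽₂^ m → ℚ) → ℚPoint m
  hadamard m c a = Σ𝔽 m (λ b → c b * H a b)

  hadamard-cong : ∀ {m} {c c′ : 𝔽₂^ m → ℚ} → (∀ b → c b ≡ c′ b) →
                  ∀ a → hadamard m c a ≡ hadamard m c′ a
  hadamard-cong {m} c≗c′ a = ∑-cong (allVecs m) (λ b → cong (_* H a b) (c≗c′ b))

  H-⊕ : ∀ {m} (p q b : 𝔽₂^ m) → H (p ⊕ q) b ≡ H p b * H q b
  H-⊕ p q b = trans (cong sign (dot-⊕ˡ p q b)) (sign-xor (dot p b) (dot q b))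

  hadamard-∷ : ∀ {m} (w : 𝔽₂^ (suc m) → ℚ) d a →
               hadamard (suc m) w (d ∷ a) ≡ hadamard m (λ b → w (false ∷ b) + sign d * w (true ∷ b)) a
  hadamard-∷ {m} w d a = begin
    hadamard (suc m) w (d ∷ a)
      ≡⟨ Σ𝔽-suc m (λ b → w b * H (d ∷ a) b) ⟩
    Σ𝔽 m w₀H + Σ𝔽 m w₁H
      ≡⟨ ∑-+ (allVecs m) w₀H w₁H ⟨
    Σ𝔽 m (λ b → w₀H b + w₁H b)
      ≡⟨ ∑-cong (allVecs m) (λ b → block (w (false ∷ b)) (w (true ∷ b)) (dot a b)) ⟩
    hadamard m (λ b → w (false ∷ b) + sign d * w (true ∷ b)) a ∎
    where
    w₀H w₁H : 𝔽₂^ m → ℚ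
    w₀H b = w (false ∷ b) * H (d ∷ a) (false ∷ b)
    w₁H b = w (true ∷ b) * H (d ∷ a) (true ∷ b)
    distrib : ∀ x y s h → x * h + y * (s * h) ≡ (x + s * y) * h
    distrib = solve-∀ ℚ-ring
    block : ∀ x y t → x * sign ((d ∧ false) xor t) + y * sign ((d ∧ true) xor t) ≡
                      (x + sign d * y) * sign t
    block x y t rewrite ∧-zeroʳ d | ∧-identityʳ d | sign-xor d t = distrib x y (sign d) (sign t)

  module _ {m} {c : 𝔽₂^ m → ℚ} (c≥0 : ∀ b → 0ℚ ≤ c b) (∑c≡1 : Σ𝔽 m c ≡ 1ℚ) where

    hadamard-bounded : ∀ a → - 1ℚ ≤ hadamard m c a × hadamard m c a ≤ 1ℚ
    hadamard-bounded a =
      ℚ.≤-trans (ℚ.≤-reflexive (trans (cong -_ (sym ∑c≡1)) (sym (∑-neg (allVecs m) c))))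
                (∑-mono (allVecs m) (λ b → proj₁ (*sign-bounds (c≥0 b) (dot a b)))) ,
      ℚ.≤-trans (∑-mono (allVecs m) (λ b → proj₂ (*sign-bounds (c≥0 b) (dot a b))))
                (ℚ.≤-reflexive ∑c≡1)

    -- Σ_b c_b (1 - (-1)^σ H(p,b)) = 0 with nonnegative terms, so c lives where H(p,·) = (-1)^σ.
    hadamard-extremal-⊕ : ∀ {p σ} → hadamard m c p ≡ sign σ →
                          ∀ q → hadamard m c (p ⊕ q) ≡ sign σ * hadamard m c q
    hadamard-extremal-⊕ {p} {σ} Hc[p]≡σ q = begin
      hadamard m c (p ⊕ q)                 ≡⟨ ∑-cong (allVecs m) shift ⟩
      Σ𝔽 m (λ b → sign σ * (c b * H q b))  ≡⟨ ∑-*ˡ (allVecs m) (sign σ) (λ b → c b * H q b) ⟩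
      sign σ * hadamard m c q              ∎
      where
      s·cH : 𝔽₂^ m → ℚ
      s·cH b = sign σ * (c b * H p b)
      s·cH≡ : ∀ b → s·cH b ≡ c b * sign (σ xor dot p b)
      s·cH≡ b = trans (swap (sign σ) (c b) (H p b)) (cong (c b *_) (sym (sign-xor σ (dot p b))))
        where
        swap : ∀ s x h → s * (x * h) ≡ x * (s * h)
        swap = solve-∀ ℚ-ring
      defect≥0 : ∀ b → 0ℚ ≤ c b - s·cH b
      defect≥0 b = p≤q⇒0≤q-p (subst (_≤ c b) (sym (s·cH≡ b)) (proj₂ (*sign-bounds (c≥0 b) (σ xor dot p b))))
      ∑defect≡0 : Σ𝔽 m (λ b → c b - s·cH b) ≡ 0ℚ
      ∑defect≡0 = begin
        Σ𝔽 m (λ b → c b - s·cH b)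
          ≡⟨ ∑-- (allVecs m) c s·cH ⟩
        Σ𝔽 m c - Σ𝔽 m s·cH
          ≡⟨ cong (λ v → Σ𝔽 m c - v) (∑-*ˡ (allVecs m) (sign σ) (λ b → c b * H p b)) ⟩
        Σ𝔽 m c - sign σ * hadamard m c p
          ≡⟨ cong₂ (λ u v → u - sign σ * v) ∑c≡1 Hc[p]≡σ ⟩
        1ℚ - sign σ * sign σ
          ≡⟨ cong (λ v → 1ℚ - v) (sign*sign σ) ⟩
        0ℚ ∎
      concentrated : ∀ b → c b ≡ s·cH b
      concentrated b = p-q≡0⇒p≡q (All.lookup (∑-nonNeg≡0 (allVecs m) defect≥0 ∑defect≡0) (allVecs-complete b))
      shift : ∀ b → c b * H (p ⊕ q) b ≡ sign σ * (c b * H q b)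
      shift b = begin
        c b * H (p ⊕ q) b                        ≡⟨ cong (c b *_) (H-⊕ p q b) ⟩
        c b * (H p b * H q b)                    ≡⟨ cong (_* (H p b * H q b)) (concentrated b) ⟩
        sign σ * (c b * H p b) * (H p b * H q b) ≡⟨ regroup (sign σ) (c b) (H p b) (H q b) ⟩
        sign σ * (c b * H q b) * (H p b * H p b) ≡⟨ cong (sign σ * (c b * H q b) *_) (sign*sign (dot p b)) ⟩
        sign σ * (c b * H q b) * 1ℚ              ≡⟨ ℚ.*-identityʳ _ ⟩
        sign σ * (c b * H q b)                   ∎
        where
        regroup : ∀ s x h k → s * (x * h) * (h * k) ≡ s * (x * k) * (h * h)
        regroup = solve-∀ ℚ-ring

    InHadamardPolytope-suc : ∀ (h : 𝔽₂^ m → ℚ) → (∀ b → - c b ≤ h b) → (∀ b → h b ≤ c b) →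
             ∀ {x : ℚPoint (suc m)} → (∀ a → hadamard m c a ≡ x (false ∷ a)) →
             (∀ a → hadamard m h a ≡ x (true ∷ a)) → InHadamardPolytope (suc m) x
    InHadamardPolytope-suc h -c≤h h≤c {x} Hc≡x₀ Hh≡x₁ = w , w≥0 , ∑w≡1 , Hw≡x
      where
      w : 𝔽₂^ (suc m) → ℚ
      w (false ∷ b) = ½ * (c b + h b)
      w (true ∷ b) = ½ * (c b - h b)
      half≥0 : ∀ {y} → 0ℚ ≤ y → 0ℚ ≤ ½ * y
      half≥0 = ℚ.*-monoˡ-≤-nonNeg ½
      w≥0 : ∀ b → 0ℚ ≤ w b
      w≥0 (false ∷ b) = half≥0 (subst (_≤ c b + h b) (ℚ.+-inverseʳ (c b)) (ℚ.+-monoʳ-≤ (c b) (-c≤h b)))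
      w≥0 (true ∷ b) = half≥0 (p≤q⇒0≤q-p (h≤c b))
      halves⁺ : ∀ x y → ½ * (x + y) + 1ℚ * (½ * (x - y)) ≡ x
      halves⁺ = solve-∀ ℚ-ring
      halves⁻ : ∀ x y → ½ * (x + y) + - 1ℚ * (½ * (x - y)) ≡ y
      halves⁻ = solve-∀ ℚ-ring
      ∑w≡1 : Σ𝔽 (suc m) w ≡ 1ℚ
      ∑w≡1 = begin
        Σ𝔽 (suc m) w
          ≡⟨ Σ𝔽-suc m w ⟩
        Σ𝔽 m (λ b → w (false ∷ b)) + Σ𝔽 m (λ b → w (true ∷ b))
          ≡⟨ ∑-+ (allVecs m) (λ b → w (false ∷ b)) (λ b → w (true ∷ b)) ⟨
        Σ𝔽 m (λ b → w (false ∷ b) + w (true ∷ b))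
          ≡⟨ ∑-cong (allVecs m) (λ b → trans (cong (w (false ∷ b) +_) (sym (ℚ.*-identityˡ _)))
                                             (halves⁺ (c b) (h b))) ⟩
        Σ𝔽 m c
          ≡⟨ ∑c≡1 ⟩
        1ℚ ∎
      Hw≡x : ∀ a → hadamard (suc m) w a ≡ x a
      Hw≡x (false ∷ a) = trans (hadamard-∷ w false a)
                               (trans (hadamard-cong (λ b → halves⁺ (c b) (h b)) a) (Hc≡x₀ a))
      Hw≡x (true ∷ a) = trans (hadamard-∷ w true a)
                              (trans (hadamard-cong (λ b → halves⁻ (c b) (h b)) a) (Hh≡x₁ a))

  IntegerPoint₀-one : IntegerPoint 0 one₀
  IntegerPoint₀-one = (λ _ → 1ℚ) , (λ _ → *≤* (ℤ.+≤+ z≤n)) , refl , λ { [] → refl }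

  IntegerPoint₀⇒≗one : ∀ {x} → IntegerPoint 0 x → x ≗ one₀
  IntegerPoint₀⇒≗one {x} (c , _ , ∑c≡1 , Hc≡x) [] = /1-injective (begin
    x [] / 1          ≡⟨ Hc≡x [] ⟨
    c [] * 1ℚ + 0ℚ    ≡⟨ cong (_+ 0ℚ) (ℚ.*-identityʳ (c [])) ⟩
    c [] + 0ℚ         ≡⟨ ∑c≡1 ⟩
    1ℚ                ∎)

  IntegerPoint-lowerHalf : ∀ {m x} → IntegerPoint (suc m) x → IntegerPoint m (lowerHalf x)
  IntegerPoint-lowerHalf {m} {x} (w , w≥0 , ∑w≡1 , Hw≡x) = c , c≥0 , ∑c≡1 , Hc≡x
    where
    c : 𝔽₂^ m → ℚ
    c b = w (false ∷ b) + w (true ∷ b)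
    c≥0 : ∀ b → 0ℚ ≤ c b
    c≥0 b = ℚ.+-mono-≤ (w≥0 (false ∷ b)) (w≥0 (true ∷ b))
    ∑c≡1 : Σ𝔽 m c ≡ 1ℚ
    ∑c≡1 = trans (∑-+ (allVecs m) (λ b → w (false ∷ b)) (λ b → w (true ∷ b)))
                 (trans (sym (Σ𝔽-suc m w)) ∑w≡1)
    Hc≡x : ∀ a → hadamard m c a ≡ x (false ∷ a) / 1
    Hc≡x a = begin
      hadamard m c a
        ≡⟨ hadamard-cong (λ b → cong (w (false ∷ b) +_) (sym (ℚ.*-identityˡ (w (true ∷ b))))) a ⟩
      hadamard m (λ b → w (false ∷ b) + sign false * w (true ∷ b)) a
        ≡⟨ hadamard-∷ w false a ⟨
      hadamard (suc m) w (false ∷ a)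
        ≡⟨ Hw≡x (false ∷ a) ⟩
      x (false ∷ a) / 1 ∎

  IntegerPoint-extend : ∀ {m y} → IntegerPoint m y → ∀ t → IntegerPoint (suc m) (extend y t)
  IntegerPoint-extend {m} (c , c≥0 , ∑c≡1 , Hc≡y) nothing =
    InHadamardPolytope-suc c≥0 ∑c≡1 (λ _ → 0ℚ) (λ b → ℚ.neg-antimono-≤ (c≥0 b)) c≥0 Hc≡y H0≡0
    where
    H0≡0 : ∀ a → hadamard m (λ _ → 0ℚ) a ≡ 0ℚ
    H0≡0 a = trans (∑-cong (allVecs m) (λ b → ℚ.*-zeroˡ (H a b))) (∑-0 (allVecs m))
  IntegerPoint-extend {m} {y} (c , c≥0 , ∑c≡1 , Hc≡y) (just (σ , s)) =
    InHadamardPolytope-suc c≥0 ∑c≡1 h (proj₁ ∘ h-bounds) (proj₂ ∘ h-bounds) Hc≡y Hh≡shift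
    where
    h : 𝔽₂^ m → ℚ
    h b = c b * sign (σ xor dot s b)
    h-bounds : ∀ b → - c b ≤ h b × h b ≤ c b
    h-bounds b = *sign-bounds (c≥0 b) (σ xor dot s b)
    regroup : ∀ x u v w → x * (u * v) * w ≡ u * (x * (v * w))
    regroup = solve-∀ ℚ-ring
    hH≡ : ∀ a b → h b * H a b ≡ sign σ * (c b * H (s ⊕ a) b)
    hH≡ a b = begin
      c b * sign (σ xor dot s b) * H a b    ≡⟨ cong (λ v → c b * v * H a b) (sign-xor σ (dot s b)) ⟩
      c b * (sign σ * H s b) * H a b        ≡⟨ regroup (c b) (sign σ) (H s b) (H a b) ⟩
      sign σ * (c b * (H s b * H a b))      ≡⟨ cong (λ v → sign σ * (c b * v)) (H-⊕ s a b) ⟨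
      sign σ * (c b * H (s ⊕ a) b)          ∎
    Hh≡shift : ∀ a → hadamard m h a ≡ signed σ (y (s ⊕ a)) / 1
    Hh≡shift a = begin
      hadamard m h a
        ≡⟨ ∑-cong (allVecs m) (hH≡ a) ⟩
      Σ𝔽 m (λ b → sign σ * (c b * H (s ⊕ a) b))
        ≡⟨ ∑-*ˡ (allVecs m) (sign σ) (λ b → c b * H (s ⊕ a) b) ⟩
      sign σ * hadamard m c (s ⊕ a)
        ≡⟨ cong (sign σ *_) (Hc≡y (s ⊕ a)) ⟩
      sign σ * (y (s ⊕ a) / 1)
        ≡⟨ signed-/1 σ (y (s ⊕ a)) ⟨
      signed σ (y (s ⊕ a)) / 1 ∎

  upperHalf≢0⇒shift : ∀ {m x s} → IntegerPoint (suc m) x → x (true ∷ s) ≢ 0ℤ →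
                      Σ Bool λ σ → ∀ a → x (true ∷ a) ≡ signed σ (x (false ∷ (s ⊕ a)))
  upperHalf≢0⇒shift {m} {x} {s} (w , w≥0 , ∑w≡1 , Hw≡x) x[s]≢0 = σ , x[a]≡
    where
    Hw[s]≡fromℤ : hadamard (suc m) w (true ∷ s) ≡ fromℤ (x (true ∷ s))
    Hw[s]≡fromℤ = trans (Hw≡x (true ∷ s)) (/1≡fromℤ (x (true ∷ s)))
    bounded : - 1ℚ ≤ hadamard (suc m) w (true ∷ s) × hadamard (suc m) w (true ∷ s) ≤ 1ℚ
    bounded = hadamard-bounded w≥0 ∑w≡1 (true ∷ s)
    unit : Σ Bool λ σ → fromℤ (x (true ∷ s)) ≡ sign σ
    unit = fromℤ-unit (x (true ∷ s)) (subst (- 1ℚ ≤_) Hw[s]≡fromℤ (proj₁ bounded))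
                      (subst (_≤ 1ℚ) Hw[s]≡fromℤ (proj₂ bounded)) x[s]≢0
    σ : Bool
    σ = proj₁ unit
    Hw[s]≡σ : hadamard (suc m) w (true ∷ s) ≡ sign σ
    Hw[s]≡σ = trans Hw[s]≡fromℤ (proj₂ unit)
    x[a]≡ : ∀ a → x (true ∷ a) ≡ signed σ (x (false ∷ (s ⊕ a)))
    x[a]≡ a = /1-injective (begin
      x (true ∷ a) / 1
        ≡⟨ Hw≡x (true ∷ a) ⟨
      hadamard (suc m) w (true ∷ a)
        ≡⟨ cong (λ v → hadamard (suc m) w (true ∷ v)) (⊕-cancelˡ s a) ⟨
      hadamard (suc m) w ((true ∷ s) ⊕ (false ∷ (s ⊕ a)))
        ≡⟨ hadamard-extremal-⊕ w≥0 ∑w≡1 {true ∷ s} Hw[s]≡σ (false ∷ (s ⊕ a)) ⟩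
      sign σ * hadamard (suc m) w (false ∷ (s ⊕ a))
        ≡⟨ cong (sign σ *_) (Hw≡x (false ∷ (s ⊕ a))) ⟩
      sign σ * (x (false ∷ (s ⊕ a)) / 1)
        ≡⟨ signed-/1 σ (x (false ∷ (s ⊕ a))) ⟨
      signed σ (x (false ∷ (s ⊕ a))) / 1 ∎)

  IntegerPoint⇒≗extend : ∀ {m x} → IntegerPoint (suc m) x → Σ (Shape m) λ t → x ≗ extend (lowerHalf x) t
  IntegerPoint⇒≗extend {m} {x} x∈𝓗 with ∀-or-∃¬ (λ a → x (true ∷ a) ℤ.≟ 0ℤ)
  ... | inj₁ upper≡0 = nothing , ≗-extend upper≡0
  ... | inj₂ (s , x[s]≢0) =
    let σ , upper≡shift = upperHalf≢0⇒shift {x = x} {s} x∈𝓗 x[s]≢0 in just (σ , s) , ≗-extend upper≡shift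

open Polytope
  using (IntegerPoint₀-one; IntegerPoint₀⇒≗one; IntegerPoint-lowerHalf; IntegerPoint-extend;
         IntegerPoint⇒≗extend)

-- ℕ's arithmetic is opened only now: its operators share their names with those of ℚ used above.
open import Data.Nat using (_≤_; _+_; _*_; _^_; NonZero; ⌊_/2⌋; ⌈_/2⌉)
import Data.Nat.Properties as ℕ
open import Data.Nat.Tactic.RingSolver using (solve-∀)
open import Data.List.Properties using (length-map; length-++; length-removeAt′; length-deduplicate)
open import Data.List.Relation.Unary.AllPairs using ([]; _∷_)
import Data.List.Relation.Unary.AllPairs.Properties as AllPairsₚ
open import Data.List.Relation.Unary.Unique.Setoid using (Unique)
import Data.List.Relation.Unary.Unique.Setoid.Properties as Uniqueₚ
open import Data.List.Relation.Unary.Unique.DecSetoid.Properties using (deduplicate-!)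
import Data.List.Membership.Setoid.Properties as Membershipₚ

module _ {a ℓ} (S : Setoid a ℓ) where

  open Setoid S using (_≈_) renaming (trans to ≈-trans; sym to ≈-sym)

  ∈-─⁺ : ∀ {x y xs} (x∈xs : Any (x ≈_) xs) → Any (y ≈_) xs → ¬ y ≈ x → Any (y ≈_) (xs ─ x∈xs)
  ∈-─⁺ (here x≈z) (here y≈z) y≉x = contradiction (≈-trans y≈z (≈-sym x≈z)) y≉x
  ∈-─⁺ (here _) (there y∈xs) _ = y∈xs
  ∈-─⁺ (there _) (here y≈z) _ = here y≈z
  ∈-─⁺ (there x∈xs) (there y∈xs) y≉x = there (∈-─⁺ x∈xs y∈xs y≉x)

  Unique-⊆⇒length≤ : ∀ {xs ys} → Unique S xs → All (λ x → Any (x ≈_) ys) xs → length xs ≤ length ys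
  Unique-⊆⇒length≤ [] [] = z≤n
  Unique-⊆⇒length≤ {x ∷ xs} {ys} (x≉xs ∷ xs!) (x∈ys ∷ xs⊆ys) = begin
    suc (length xs)               ≤⟨ s≤s (Unique-⊆⇒length≤ xs! xs⊆ys─x) ⟩
    suc (length (ys ─ x∈ys))      ≡⟨ length-removeAt′ ys (Any.index x∈ys) ⟨
    length ys                     ∎
    where
    open ℕ.≤-Reasoning
    xs⊆ys─x : All (λ y → Any (y ≈_) (ys ─ x∈ys)) xs
    xs⊆ys─x = All.zipWith (λ (x≉y , y∈ys) → ∈-─⁺ x∈ys y∈ys (x≉y ∘ ≈-sym)) (x≉xs , xs⊆ys)

length-cartesianProductWith : ∀ {A B C : Set} (f : A → B → C) xs ys →
                              length (cartesianProductWith f xs ys) ≡ length xs * length ys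
length-cartesianProductWith f [] ys = refl
length-cartesianProductWith f (x ∷ xs) ys = begin
  length (List.map (f x) ys List.++ cartesianProductWith f xs ys)
    ≡⟨ length-++ (List.map (f x) ys) ⟩
  length (List.map (f x) ys) + length (cartesianProductWith f xs ys)
    ≡⟨ cong₂ _+_ (length-map (f x) ys) (length-cartesianProductWith f xs ys) ⟩
  length ys + length xs * length ys ∎
  where open ≡-Reasoning

allVecs-length : ∀ m → length (allVecs m) ≡ 2 ^ m
allVecs-length zero = refl
allVecs-length (suc m) = begin
  length (List.map (false ∷_) (allVecs m) List.++ List.map (true ∷_) (allVecs m))
    ≡⟨ length-++ (List.map (false ∷_) (allVecs m)) ⟩
  length (List.map (false ∷_) (allVecs m)) + length (List.map (true ∷_) (allVecs m))
    ≡⟨ cong₂ _+_ (length-map (false ∷_) (allVecs m)) (length-map (true ∷_) (allVecs m)) ⟩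
  length (allVecs m) + length (allVecs m)
    ≡⟨ cong (λ n → n + n) (allVecs-length m) ⟩
  2 ^ m + 2 ^ m
    ≡⟨ cong (2 ^ m +_) (ℕ.+-identityʳ (2 ^ m)) ⟨
  2 ^ suc m ∎
  where open ≡-Reasoning

allVecs-unique : ∀ m → Unique (setoid (𝔽₂^ m)) (allVecs m)
allVecs-unique zero = [] ∷ []
allVecs-unique (suc m) =
  AllPairsₚ.++⁺ (Uniqueₚ.map⁺ (setoid _) (setoid _) ∷-injectiveʳ (allVecs-unique m))
               (Uniqueₚ.map⁺ (setoid _) (setoid _) ∷-injectiveʳ (allVecs-unique m))
               (Allₚ.map⁺ (All.universal (λ a → Allₚ.map⁺ (All.universal (λ b ()) (allVecs m)))
                                         (allVecs m)))

≗-dec : ∀ {m} (x y : ℤPoint m) → Dec (x ≗ y)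
≗-dec x y with ∀-or-∃¬ (λ a → x a ℤ.≟ y a)
... | inj₁ x≗y = yes x≗y
... | inj₂ (a , x[a]≢y[a]) = no (λ x≗y → x[a]≢y[a] (x≗y a))

pointDecSetoid : ℕ → DecSetoid 0ℓ 0ℓ
pointDecSetoid m = record
  { Carrier = ℤPoint m
  ; _≈_ = _≗_
  ; isDecEquivalence = record
    { isEquivalence = Setoid.isEquivalence (𝔽₂^ m →-setoid ℤ)
    ; _≟_ = ≗-dec
    }
  }

pointSetoid : ℕ → Setoid 0ℓ 0ℓ
pointSetoid m = DecSetoid.setoid (pointDecSetoid m)

shapes : ∀ m → List (Shape m)
shapes m = nothing ∷ List.map just (cartesianProduct (false ∷ true ∷ []) (allVecs m))

shapes-complete : ∀ {m} (t : Shape m) → t ∈ shapes m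
shapes-complete nothing = here refl
shapes-complete (just (σ , s)) = there (∈-map⁺ just (∈-cartesianProduct⁺ (σ∈ σ) (allVecs-complete s)))
  where
  σ∈ : ∀ σ → σ ∈ false ∷ true ∷ []
  σ∈ false = here refl
  σ∈ true = there (here refl)

length-shapes≤ : ∀ m → length (shapes m) ≤ 2 ^ suc (suc m)
length-shapes≤ m = begin
  suc (length (List.map just (cartesianProduct (false ∷ true ∷ []) (allVecs m))))
    ≡⟨ cong suc (length-map just (cartesianProduct (false ∷ true ∷ []) (allVecs m))) ⟩
  suc (length (cartesianProduct (false ∷ true ∷ []) (allVecs m)))
    ≡⟨ cong suc (length-cartesianProductWith _,_ (false ∷ true ∷ []) (allVecs m)) ⟩
  suc (2 * length (allVecs m))
    ≡⟨ cong (λ n → suc (2 * n)) (allVecs-length m) ⟩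
  suc (2 ^ suc m)
    ≤⟨ ℕ.+-monoˡ-≤ (2 ^ suc m) (ℕ.m^n>0 2 (suc m)) ⟩
  2 ^ suc m + 2 ^ suc m
    ≡⟨ cong (2 ^ suc m +_) (ℕ.+-identityʳ (2 ^ suc m)) ⟨
  2 ^ suc (suc m) ∎
  where open ℕ.≤-Reasoning

points : ∀ m → List (ℤPoint m)
points zero = one₀ ∷ []
points (suc m) = deduplicate ≗-dec (cartesianProductWith extend (points m) (shapes m))

points-sound : ∀ m → All (IntegerPoint m) (points m)
points-sound zero = IntegerPoint₀-one ∷ []
points-sound (suc m) = Allₚ.deduplicate⁺ ≗-dec
  (Allₚ.cartesianProductWith⁺ (setoid (ℤPoint m)) (setoid (Shape m)) extend (points m) (shapes m)
  (λ y∈ _ → IntegerPoint-extend (All.lookup (points-sound m) y∈) _))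

points-complete : ∀ {m} (x : ℤPoint m) → IntegerPoint m x → Any (x ≗_) (points m)
points-complete {zero} x x∈𝓗 = here (IntegerPoint₀⇒≗one x∈𝓗)
points-complete {suc m} x x∈𝓗 =
  Membershipₚ.∈-deduplicate⁺ (pointSetoid (suc m)) ≗-dec (λ z≗y x≗y a → trans (x≗y a) (sym (z≗y a)))
    (Membershipₚ.∈-resp-≈ (pointSetoid (suc m)) (λ a → sym (x≗extend a))
      (Membershipₚ.∈-cartesianProductWith⁺ (pointSetoid m) (setoid (Shape m)) (pointSetoid (suc m))
        extend-cong (points-complete (lowerHalf x) (IntegerPoint-lowerHalf {x = x} x∈𝓗))
        (shapes-complete t)))
  where
  t = proj₁ (IntegerPoint⇒≗extend {x = x} x∈𝓗)
  x≗extend = proj₂ (IntegerPoint⇒≗extend {x = x} x∈𝓗)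

points-unique : ∀ m → Unique (pointSetoid m) (points m)
points-unique zero = [] ∷ []
points-unique (suc m) = deduplicate-! (pointDecSetoid (suc m)) _

points-count : ∀ m → NumIntegerPoints m (length (points m))
points-count m = points m , refl , points-sound m , points-complete , points-unique m

length-points≤ : ∀ m → length (points m) ≤ 2 ^ (m * suc m)
length-points≤ zero = s≤s z≤n
length-points≤ (suc m) = begin
  length (points (suc m))
    ≤⟨ length-deduplicate ≗-dec (cartesianProductWith extend (points m) (shapes m)) ⟩
  length (cartesianProductWith extend (points m) (shapes m))
    ≡⟨ length-cartesianProductWith extend (points m) (shapes m) ⟩
  length (points m) * length (shapes m)
    ≤⟨ ℕ.*-mono-≤ (length-points≤ m) (length-shapes≤ m) ⟩
  2 ^ (m * suc m) * 2 ^ suc (suc m)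
    ≡⟨ ℕ.^-distribˡ-+-* 2 (m * suc m) (suc (suc m)) ⟨
  2 ^ (m * suc m + suc (suc m))
    ≤⟨ ℕ.^-monoʳ-≤ 2 (ℕ.≤-trans (ℕ.m≤m+n _ m) (ℕ.≤-reflexive (exponent m))) ⟩
  2 ^ (suc m * suc (suc m)) ∎
  where
  open ℕ.≤-Reasoning
  exponent : ∀ m → m * suc m + suc (suc m) + m ≡ suc m * suc (suc m)
  exponent = solve-∀

δ₀ : ∀ k → ℤPoint k
δ₀ zero = one₀
δ₀ (suc k) = extend (δ₀ k) nothing

δ₀-zeros : ∀ k → δ₀ k (zeros k) ≡ 1ℤ
δ₀-zeros zero = refl
δ₀-zeros (suc k) = δ₀-zeros k

δ₀≡1⇒zeros : ∀ {k} (u : 𝔽₂^ k) → δ₀ k u ≡ 1ℤ → u ≡ zeros k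
δ₀≡1⇒zeros [] _ = refl
δ₀≡1⇒zeros (false ∷ u) δ₀[u]≡1 = cong (false ∷_) (δ₀≡1⇒zeros u δ₀[u]≡1)
δ₀≡1⇒zeros (true ∷ u) ()

δ₀-IntegerPoint : ∀ k → IntegerPoint k (δ₀ k)
δ₀-IntegerPoint zero = IntegerPoint₀-one
δ₀-IntegerPoint (suc k) = IntegerPoint-extend (δ₀-IntegerPoint k) nothing

-- graphPoint k j v is the indicator of the graph {(t , R t)} of the linear map R : F₂^j → F₂^k
-- whose i-th column is the i-th block of k bits of v.
graphPoint : ∀ k j → Vec Bool (j * k) → ℤPoint (j + k)
graphPoint k zero _ = δ₀ k
graphPoint k (suc j) v = extend (graphPoint k j (drop k v)) (just (false , zeros j ++ take k v))

graphPoint-IntegerPoint : ∀ k j v → IntegerPoint (j + k) (graphPoint k j v)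
graphPoint-IntegerPoint k zero _ = δ₀-IntegerPoint k
graphPoint-IntegerPoint k (suc j) v =
  IntegerPoint-extend (graphPoint-IntegerPoint k j (drop k v)) (just (false , zeros j ++ take k v))

graphPoint-zeros++ : ∀ k j v (u : 𝔽₂^ k) → graphPoint k j v (zeros j ++ u) ≡ δ₀ k u
graphPoint-zeros++ k zero v u = refl
graphPoint-zeros++ k (suc j) v u = graphPoint-zeros++ k j (drop k v) u

graphPoint-true∷ : ∀ k j v (w : 𝔽₂^ k) →
                   graphPoint k (suc j) v (true ∷ (zeros j ++ w)) ≡ δ₀ k (take k v ⊕ w)
graphPoint-true∷ k j v w = begin
  graphPoint k j (drop k v) ((zeros j ++ take k v) ⊕ (zeros j ++ w))
    ≡⟨ cong (graphPoint k j (drop k v)) (zeros++-⊕ j (take k v) w) ⟩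
  graphPoint k j (drop k v) (zeros j ++ (take k v ⊕ w))
    ≡⟨ graphPoint-zeros++ k j (drop k v) (take k v ⊕ w) ⟩
  δ₀ k (take k v ⊕ w) ∎
  where open ≡-Reasoning

graphPoint-injective : ∀ k j {v v′} → graphPoint k j v ≗ graphPoint k j v′ → v ≡ v′
graphPoint-injective k zero {[]} {[]} _ = refl
graphPoint-injective k (suc j) {v} {v′} v≗v′ = begin
  v                        ≡⟨ take++drop≡id k v ⟨
  take k v ++ drop k v     ≡⟨ cong₂ _++_ take≡ drop≡ ⟩
  take k v′ ++ drop k v′   ≡⟨ take++drop≡id k v′ ⟩
  v′                       ∎
  where
  open ≡-Reasoning
  drop≡ : drop k v ≡ drop k v′
  drop≡ = graphPoint-injective k j (λ a → v≗v′ (false ∷ a))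
  r = take k v
  δ₀[r′⊕r]≡1 : δ₀ k (take k v′ ⊕ r) ≡ 1ℤ
  δ₀[r′⊕r]≡1 = begin
    δ₀ k (take k v′ ⊕ r)                     ≡⟨ graphPoint-true∷ k j v′ r ⟨
    graphPoint k (suc j) v′ (true ∷ (zeros j ++ r)) ≡⟨ v≗v′ (true ∷ (zeros j ++ r)) ⟨
    graphPoint k (suc j) v (true ∷ (zeros j ++ r))  ≡⟨ graphPoint-true∷ k j v r ⟩
    δ₀ k (r ⊕ r)                             ≡⟨ cong (δ₀ k) (⊕-self r) ⟩
    δ₀ k (zeros k)                           ≡⟨ δ₀-zeros k ⟩
    1ℤ                                       ∎
  take≡ : r ≡ take k v′
  take≡ = sym (⊕≡zeros⇒≡ (take k v′) r (δ₀≡1⇒zeros (take k v′ ⊕ r) δ₀[r′⊕r]≡1))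

length-points≥ : ∀ k j → 2 ^ (j * k) ≤ length (points (j + k))
length-points≥ k j = begin
  2 ^ (j * k)
    ≡⟨ allVecs-length (j * k) ⟨
  length (allVecs (j * k))
    ≡⟨ length-map (graphPoint k j) (allVecs (j * k)) ⟨
  length graphs
    ≤⟨ Unique-⊆⇒length≤ (pointSetoid (j + k)) graphs-unique graphs⊆points ⟩
  length (points (j + k)) ∎
  where
  open ℕ.≤-Reasoning
  graphs : List (ℤPoint (j + k))
  graphs = List.map (graphPoint k j) (allVecs (j * k))
  graphs-unique : Unique (pointSetoid (j + k)) graphs
  graphs-unique = Uniqueₚ.map⁺ (setoid _) (pointSetoid (j + k)) (graphPoint-injective k j)
                               (allVecs-unique (j * k))
  graphs⊆points : All (λ x → Any (x ≗_) (points (j + k))) graphs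
  graphs⊆points = Allₚ.map⁺ (All.universal (λ v → points-complete _ (graphPoint-IntegerPoint k j v))
                                           (allVecs (j * k)))

length-points-upper : ∀ m → 1 ≤ m → length (points m) ≤ 2 ^ (2 * (m * m))
length-points-upper m 1≤m = ℕ.≤-trans (length-points≤ m) (ℕ.^-monoʳ-≤ 2 (begin
  m * suc m       ≡⟨ ℕ.*-suc m m ⟩
  m + m * m       ≤⟨ ℕ.+-monoˡ-≤ (m * m) m≤m*m ⟩
  m * m + m * m   ≡⟨ cong (m * m +_) (ℕ.+-identityʳ (m * m)) ⟨
  2 * (m * m)     ∎))
  where
  open ℕ.≤-Reasoning
  m≤m*m : m ≤ m * m
  m≤m*m = subst (_≤ m * m) (ℕ.*-identityʳ m) (ℕ.*-monoʳ-≤ m 1≤m)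

⌈n/2⌉≤1+⌊n/2⌋ : ∀ n → ⌈ n /2⌉ ≤ suc ⌊ n /2⌋
⌈n/2⌉≤1+⌊n/2⌋ zero = z≤n
⌈n/2⌉≤1+⌊n/2⌋ (suc zero) = s≤s z≤n
⌈n/2⌉≤1+⌊n/2⌋ (suc (suc n)) = s≤s (⌈n/2⌉≤1+⌊n/2⌋ n)

m*m≤6*⌈m/2⌉*⌊m/2⌋ : ∀ m → 2 ≤ m → m * m ≤ 6 * (⌈ m /2⌉ * ⌊ m /2⌋)
m*m≤6*⌈m/2⌉*⌊m/2⌋ m 2≤m = begin
  m * m               ≤⟨ ℕ.*-mono-≤ m≤2j m≤3k ⟩
  (2 * j) * (3 * k)   ≡⟨ regroup j k ⟩
  6 * (j * k)         ∎
  where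
  open ℕ.≤-Reasoning
  j k : ℕ
  j = ⌈ m /2⌉
  k = ⌊ m /2⌋
  regroup : ∀ j k → (2 * j) * (3 * k) ≡ 6 * (j * k)
  regroup = solve-∀
  m≡k+j : m ≡ k + j
  m≡k+j = sym (ℕ.⌊n/2⌋+⌈n/2⌉≡n m)
  m≤2j : m ≤ 2 * j
  m≤2j = begin
    m        ≡⟨ m≡k+j ⟩
    k + j    ≤⟨ ℕ.+-monoˡ-≤ j (ℕ.⌊n/2⌋≤⌈n/2⌉ m) ⟩
    j + j    ≡⟨ cong (j +_) (ℕ.+-identityʳ j) ⟨
    2 * j    ∎
  m≤3k : m ≤ 3 * k
  m≤3k = begin
    m             ≡⟨ m≡k+j ⟩
    k + j         ≤⟨ ℕ.+-monoʳ-≤ k (⌈n/2⌉≤1+⌊n/2⌋ m) ⟩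
    k + suc k     ≤⟨ ℕ.+-monoʳ-≤ k (ℕ.+-monoˡ-≤ k (ℕ.⌊n/2⌋-mono 2≤m)) ⟩
    k + (k + k)   ≡⟨ cong (λ n → k + (k + n)) (ℕ.+-identityʳ k) ⟨
    3 * k         ∎

length-points-lower : ∀ m → 2 ≤ m → 2 ^ (m * m) ≤ length (points m) ^ 6
length-points-lower m 2≤m = begin
  2 ^ (m * m)                   ≤⟨ ℕ.^-monoʳ-≤ 2 (m*m≤6*⌈m/2⌉*⌊m/2⌋ m 2≤m) ⟩
  2 ^ (6 * (j * k))             ≡⟨ cong (2 ^_) (ℕ.*-comm 6 (j * k)) ⟩
  2 ^ (j * k * 6)               ≡⟨ ℕ.^-*-assoc 2 (j * k) 6 ⟨
  (2 ^ (j * k)) ^ 6             ≤⟨ ℕ.^-monoˡ-≤ 6 (length-points≥ k j) ⟩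
  length (points (j + k)) ^ 6   ≡⟨ cong (λ n → length (points n) ^ 6) j+k≡m ⟩
  length (points m) ^ 6         ∎
  where
  open ℕ.≤-Reasoning
  j k : ℕ
  j = ⌈ m /2⌉
  k = ⌊ m /2⌋
  j+k≡m : j + k ≡ m
  j+k≡m = trans (ℕ.+-comm j k) (ℕ.⌊n/2⌋+⌈n/2⌉≡n m)

corollary1 :
    -- constants C₁ = p₁/q₁ > 0, C₂ = p₂/q₂ > 0, threshold M
    Σ ℕ λ p₁ → Σ ℕ λ q₁ → Σ ℕ λ p₂ → Σ ℕ λ q₂ → Σ ℕ λ M →
      NonZero p₁ × NonZero q₁ × NonZero p₂ × NonZero q₂ ×
      (∀ m → M ≤ m →
        Σ ℕ λ N → NumIntegerPoints m N ×
          -- n^{C₁ log n} = 2^{C₁ m²} ≤ N   ⇔   2^{p₁ m²} ≤ N^{q₁}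
          (2 ^ (p₁ * (m * m)) ≤ N ^ q₁) ×
          -- N ≤ n^{C₂ log n} = 2^{C₂ m²}   ⇔   N^{q₂} ≤ 2^{p₂ m²}
          (N ^ q₂ ≤ 2 ^ (p₂ * (m * m))))
corollary1 = 1 , 6 , 2 , 1 , 2 , _ , _ , _ , _ , λ m 2≤m →
  length (points m) , points-count m ,
  subst (_≤ length (points m) ^ 6) (cong (2 ^_) (sym (ℕ.*-identityˡ (m * m))))
        (length-points-lower m 2≤m) ,
  subst (_≤ 2 ^ (2 * (m * m))) (sym (ℕ.^-identityʳ (length (points m))))
        (length-points-upper m (ℕ.≤-trans (s≤s z≤n) 2≤m))
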